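{- Let $G=(V,E)$ be a connected graph and $\mathcal{F}\subseteq 2^V$ a family of sets. Define $c_1:E\to\mathbb{Z}_+$ by $c_1(e)=|\{F\in\mathcal{F}: e\subseteq F\}|$. If there exists an $\mathcal{F}$-tight spanning tree, then the $\mathcal{F}$-tight spanning trees are exactly the maximum $c_1$-cost spanning trees of $G$.
   Context: A spanning tree $B\subseteq E$ is $\mathcal{F}$-tight if $B[F]$ (the edges of $B$ with both ends in $F$, on node set $F$) is a tree spanning $F$ for every $F\in\mathcal{F}$. The $c_1$-cost of $B$ is $\sum_{e\in B}c_1(e)$. -}

module Defs where

open import Data.Nat using (ℕ; zero; suc; _≤_)
open import Data.Fin using (Fin; zero; suc; inject₁; fromℕ)
open import Data.Fin.Subset using (Subset; _∈_; _∉_)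
open import Data.Fin.Subset.Properties using (_∈?_)
import Data.Fin.Subset as S
open import Data.Vec using (lookup)
open import Data.Bool using (if_then_else_)
open import Data.List using (List; length; filter; map; allFin)
open import Data.Nat.ListAction using (sum)
import Data.List.Membership.Propositional as L
open import Data.Product using (_×_; _,_; Σ; ∃; ∃-syntax; proj₁; proj₂)
open import Data.Sum using (_⊎_)
open import Data.Unit using (⊤)
open import Relation.Nullary using (¬_)
open import Relation.Nullary.Decidable using (_×-dec_)
open import Relation.Binary.PropositionalEquality using (_≡_; _≢_)
open import Function.Definitions using (Injective)
open import Function.Bundles using (_⇔_)

Ends : ℕ → ℕ → Set
Ends n m = Fin m → Fin n × Fin n

module _ {n m : ℕ} (ends : Ends n m) where

  Joins : Fin m → Fin n → Fin n → Set
  Joins e x y = (ends e ≡ (x , y)) ⊎ (ends e ≡ (y , x))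

  Simple : Set
  Simple = (∀ e → proj₁ (ends e) ≢ proj₂ (ends e))
         × (∀ e f → Joins f (proj₁ (ends e)) (proj₂ (ends e)) → e ≡ f)

  EdgeIn : Fin m → Subset n → Set
  EdgeIn e S = (proj₁ (ends e) ∈ S) × (proj₂ (ends e) ∈ S)

  data Reach (P : Fin m → Set) : Fin n → Fin n → Set where
    here : ∀ {x} → Reach P x x
    step : ∀ {x y z} e → P e → Joins e x y → Reach P y z → Reach P x z

  -- a cycle in the subgraph with edge set P: closed walk
  -- v0 e0 v1 e1 ... ek v(k+1) = v0 with pairwise distinct edges and
  -- pairwise distinct vertices v0 ... vk
  record Cycle (P : Fin m → Set) : Set where
    field
      k    : ℕ
      vs   : Fin (suc (suc k)) → Fin n
      es   : Fin (suc k) → Fin m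
      inP  : ∀ i → P (es i)
      join : ∀ i → Joins (es i) (vs (inject₁ i)) (vs (suc i))
      closed : vs (fromℕ (suc k)) ≡ vs zero
      es-inj : Injective _≡_ _≡_ es
      vs-inj : Injective _≡_ _≡_ (λ i → vs (inject₁ i))

  -- the graph with vertex set S and edge set P (all edges of P lie in S)
  -- is a tree: nonempty, connected and acyclic
  IsTreeOn : Subset n → (Fin m → Set) → Set
  IsTreeOn S P = (∃[ x ] x ∈ S)
               × (∀ x y → x ∈ S → y ∈ S → Reach P x y)
               × ¬ Cycle P

  AllEdges : Fin m → Set
  AllEdges _ = ⊤

  Connected : Set
  Connected = ∀ x y → Reach AllEdges x y

  InB : Subset m → Fin m → Set
  InB B e = e ∈ B

  SpanningTree : Subset m → Set
  SpanningTree B = IsTreeOn S.⊤ (InB B)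

  Induced : Subset m → Subset n → Fin m → Set
  Induced B F e = (e ∈ B) × EdgeIn e F

  Tight : List (Subset n) → Subset m → Set
  Tight 𝓕 B = SpanningTree B × (∀ F → F L.∈ 𝓕 → IsTreeOn F (Induced B F))

  c₁ : List (Subset n) → Fin m → ℕ
  c₁ 𝓕 e = length (filter (λ F → (proj₁ (ends e) ∈? F) ×-dec (proj₂ (ends e) ∈? F)) 𝓕)

  cost : List (Subset n) → Subset m → ℕ
  cost 𝓕 B = sum (map (λ e → if lookup B e then c₁ 𝓕 e else 0) (allFin m))

  MaxCostSpanningTree : List (Subset n) → Subset m → Set
  MaxCostSpanningTree 𝓕 B =
    SpanningTree B × (∀ B' → SpanningTree B' → cost 𝓕 B' ≤ cost 𝓕 B)

-- Write B[F] for the edges of B with both ends in F. Counting connected components, an acyclic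
-- B[F] on a nonempty F has at most |F| - 1 edges, a B[F] connecting F has at least |F| - 1, and an
-- acyclic B[F] with |F| - 1 edges connects F. The c₁-cost of B is the sum of |B[F]| over F ∈ 𝓕, so
-- an 𝓕-tight tree T, for which every term is |F| - 1, bounds every spanning tree term by term; a
-- spanning tree of the same cost must then match T in every term, i.e. be 𝓕-tight itself.
module Submission where

open import Algebra.Properties.CommutativeSemigroup using (interchange)
open import Data.Bool using (true; false; if_then_else_)
open import Data.Empty using (⊥-elim)
open import Data.Fin using (Fin; zero; suc; inject₁; fromℕ)
open import Data.Fin.Properties using (fromℕ≢inject₁; inject₁-injective) renaming (_≟_ to _≟ᶠ_)
open import Data.Fin.Subset using (Subset; _∈_; _∉_)
open import Data.Fin.Subset.Properties using (_∈?_)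
open import Data.List using (List; []; _∷_; length; filter; map; allFin)
open import Data.List.Membership.Propositional using (lose)
import Data.List.Membership.Propositional as List
open import Data.List.Membership.Propositional.Properties using (∈-allFin; ∈-filter⁺; ∈-filter⁻)
open import Data.List.Properties using (map-cong; length-tabulate; filter-≐; filter-some; filter-none; filter-all)
open import Data.List.Relation.Unary.All using (All; [])
import Data.List.Relation.Unary.All as All
open import Data.List.Relation.Unary.All.Properties using (All¬⇒¬Any; ¬Any⇒All¬)
open import Data.List.Relation.Unary.AllPairs using ([]; _∷_)
open import Data.List.Relation.Unary.Any using (here; there; any?)
open import Data.List.Relation.Unary.Unique.Propositional using (Unique)
open import Data.List.Relation.Unary.Unique.Propositional.Properties using (allFin⁺; filter⁺)
open import Data.Nat using (ℕ; zero; suc; _+_; _≤_; z≤n; s≤s)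
open import Data.Nat.ListAction using (sum)
open import Data.Nat.Properties
open import Data.Product using (Σ; _×_; _,_; proj₁; proj₂; ∃-syntax)
open import Data.Sum using (_⊎_; inj₁; inj₂)
open import Data.Vec using (lookup)
open import Data.Vec.Properties using ([]=⇒lookup; lookup⇒[]=)
open import Function using (id; _∘′_)
open import Function.Bundles using (_⇔_; mk⇔)
open import Function.Definitions using (Injective)
open import Level using (0ℓ)
open import Relation.Binary.Definitions using (DecidableEquality)
open import Relation.Binary.PropositionalEquality
open import Relation.Nullary using (¬_; Dec; yes; no; ¬?)
open import Relation.Nullary.Decidable using (_×-dec_)
open import Relation.Unary using (Pred; Decidable; _⊆_; _≐_)
open import Relation.Unary.Properties using (∁?)

open import Defs

module _ {A : Set} where

  count : {P : Pred A 0ℓ} → Decidable P → List A → ℕ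
  count P? xs = length (filter P? xs)

  module _ {P : Pred A 0ℓ} (P? : Decidable P) where

    count-pos : ∀ {x xs} → x List.∈ xs → P x → 1 ≤ count P? xs
    count-pos x∈xs px = filter-some P? (lose x∈xs px)

    count-≤1 : (∀ {x y} → P x → P y → x ≡ y) → ∀ {xs} → Unique xs → count P? xs ≤ 1
    count-≤1 P-unique {[]}     []            = z≤n
    count-≤1 P-unique {x ∷ xs} (x∉xs ∷ uxs) with P? x
    ... | yes px = s≤s (≤-reflexive (cong length (filter-none P? none)))
      where none = All.map (λ x≢y py → x≢y (P-unique px py)) x∉xs
    ... | no  _  = count-≤1 P-unique uxs

    length≡count+count∁ : ∀ xs → length xs ≡ count P? xs + count (∁? P?) xs
    length≡count+count∁ []       = refl
    length≡count+count∁ (x ∷ xs) with P? x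
    ... | yes _ = cong suc (length≡count+count∁ xs)
    ... | no  _ = trans (cong suc (length≡count+count∁ xs)) (sym (+-suc _ _))

  count-≐ : {P Q : Pred A 0ℓ} (P? : Decidable P) (Q? : Decidable Q) → P ≐ Q → ∀ xs → count P? xs ≡ count Q? xs
  count-≐ P? Q? P≐Q xs = cong length (filter-≐ P? Q? P≐Q xs)

  count-split : {P Q : Pred A 0ℓ} (P? : Decidable P) (Q? : Decidable Q) → ∀ xs →
                count P? xs ≡ count (λ x → P? x ×-dec Q? x) xs + count (λ x → P? x ×-dec ¬? (Q? x)) xs
  count-split P? Q? []       = refl
  count-split P? Q? (x ∷ xs) with P? x | Q? x
  ... | yes _ | yes _ = cong suc (count-split P? Q? xs)
  ... | yes _ | no  _ = trans (cong suc (count-split P? Q? xs)) (sym (+-suc _ _))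
  ... | no  _ | yes _ = count-split P? Q? xs
  ... | no  _ | no  _ = count-split P? Q? xs

  count-remove : (_≟_ : DecidableEquality A) {P : Pred A 0ℓ} (P? : Decidable P) {a : A} {xs : List A} →
                 Unique xs → a List.∈ xs → P a →
                 count P? xs ≡ suc (count (λ x → P? x ×-dec ¬? (x ≟ a)) xs)
  count-remove _≟_ P? {a} {xs} uxs a∈xs pa =
    trans (count-split P? (_≟ a) xs) (cong (_+ count (λ x → P? x ×-dec ¬? (x ≟ a)) xs) exactly-one)
    where
    exactly-one : count (λ x → P? x ×-dec (x ≟ a)) xs ≡ 1
    exactly-one = ≤-antisym (count-≤1 _ (λ (_ , x≡a) (_ , y≡a) → trans x≡a (sym y≡a)) uxs)
                            (count-pos _ a∈xs (pa , refl))

  sum-+ : (f g : A → ℕ) → ∀ xs → sum (map (λ x → f x + g x) xs) ≡ sum (map f xs) + sum (map g xs)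
  sum-+ f g []       = refl
  sum-+ f g (x ∷ xs) = trans (cong (f x + g x +_) (sum-+ f g xs)) (interchange +-commutativeSemigroup (f x) (g x) _ _)

  sum-mono-≤ : {f g : A → ℕ} {xs : List A} → (∀ {x} → x List.∈ xs → f x ≤ g x) → sum (map f xs) ≤ sum (map g xs)
  sum-mono-≤ {xs = []}     f≤g = z≤n
  sum-mono-≤ {xs = x ∷ xs} f≤g = +-mono-≤ (f≤g (here refl)) (sum-mono-≤ (λ x∈xs → f≤g (there x∈xs)))

  sum-mono-≤-rigid : {f g : A → ℕ} {xs : List A} → (∀ {x} → x List.∈ xs → f x ≤ g x) →
              sum (map g xs) ≤ sum (map f xs) → ∀ {x} → x List.∈ xs → g x ≤ f x
  sum-mono-≤-rigid {f} {g} {y ∷ xs} f≤g Σg≤Σf (here refl) =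
    +-cancelʳ-≤ (sum (map g xs)) _ _ (≤-trans Σg≤Σf (+-monoʳ-≤ (f y) (sum-mono-≤ (λ x∈xs → f≤g (there x∈xs)))))
  sum-mono-≤-rigid {f} {g} {y ∷ xs} f≤g Σg≤Σf (there x∈xs) =
    sum-mono-≤-rigid (λ x∈xs → f≤g (there x∈xs))
              (+-cancelˡ-≤ (g y) _ _ (≤-trans Σg≤Σf (+-monoˡ-≤ (sum (map f xs)) (f≤g (here refl))))) x∈xs

  sum-zeros : ∀ xs → sum (map (λ (_ : A) → 0) xs) ≡ 0
  sum-zeros []       = refl
  sum-zeros (_ ∷ xs) = sum-zeros xs

count-singletons : {A : Set} {P : Pred A 0ℓ} (P? : Decidable P) → ∀ xs →
                   count P? xs ≡ sum (map (λ x → count P? (x ∷ [])) xs)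
count-singletons P? []       = refl
count-singletons P? (x ∷ xs) with P? x
... | yes _ = cong suc (count-singletons P? xs)
... | no  _ = count-singletons P? xs

count-swap : {A B : Set} {R : A → B → Set} (R? : ∀ x y → Dec (R x y)) → ∀ xs ys →
             sum (map (λ x → count (R? x) ys) xs) ≡ sum (map (λ y → count (λ x → R? x y) xs) ys)
count-swap R? [] ys = sym (sum-zeros ys)
count-swap R? (x ∷ xs) ys = begin
  count (R? x) ys + sum (map (λ x′ → count (R? x′) ys) xs)
    ≡⟨ cong₂ _+_ (count-singletons (R? x) ys) (count-swap R? xs ys) ⟩
  sum (map (λ y → count (R? x) (y ∷ [])) ys) + sum (map (λ y → count (λ x′ → R? x′ y) xs) ys)
    ≡⟨ sum-+ (λ y → count (R? x) (y ∷ [])) (λ y → count (λ x′ → R? x′ y) xs) ys ⟨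
  sum (map (λ y → count (R? x) (y ∷ []) + count (λ x′ → R? x′ y) xs) ys)
    ≡⟨ cong sum (map-cong count-cons ys) ⟩
  sum (map (λ y → count (λ x′ → R? x′ y) (x ∷ xs)) ys) ∎
  where
  open ≡-Reasoning
  count-cons : ∀ y → count (R? x) (y ∷ []) + count (λ x′ → R? x′ y) xs ≡ count (λ x′ → R? x′ y) (x ∷ xs)
  count-cons y with R? x y
  ... | yes _ = refl
  ... | no  _ = refl

module Walks {n m : ℕ} (ends : Ends n m) where

  Joins-sym : ∀ {e x y} → Joins ends e x y → Joins ends e y x
  Joins-sym (inj₁ p) = inj₂ p
  Joins-sym (inj₂ p) = inj₁ p

  Joins-endpoint : ∀ {e x y a b} → Joins ends e x y → Joins ends e a b → x ≡ a ⊎ x ≡ b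
  Joins-endpoint (inj₁ p) (inj₁ q) = inj₁ (cong proj₁ (trans (sym p) q))
  Joins-endpoint (inj₁ p) (inj₂ q) = inj₂ (cong proj₁ (trans (sym p) q))
  Joins-endpoint (inj₂ p) (inj₁ q) = inj₂ (cong proj₂ (trans (sym p) q))
  Joins-endpoint (inj₂ p) (inj₂ q) = inj₁ (cong proj₂ (trans (sym p) q))

  Joins-resp : {A : Set} (g : Fin n → A) → ∀ {e x y} →
               g (proj₁ (ends e)) ≡ g (proj₂ (ends e)) → Joins ends e x y → g x ≡ g y
  Joins-resp g eq (inj₁ p) = subst₂ (λ x y → g x ≡ g y) (cong proj₁ p) (cong proj₂ p) eq
  Joins-resp g eq (inj₂ p) = sym (subst₂ (λ y x → g y ≡ g x) (cong proj₁ p) (cong proj₂ p) eq)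

  module _ {P : Fin m → Set} where

    Reach-edge : ∀ {e x y} → P e → Joins ends e x y → Reach ends P x y
    Reach-edge pe j = step _ pe j here

    Reach-trans : ∀ {x y z} → Reach ends P x y → Reach ends P y z → Reach ends P x z
    Reach-trans here             w′ = w′
    Reach-trans (step e pe j w) w′ = step e pe j (Reach-trans w w′)

    Reach-sym : ∀ {x y} → Reach ends P x y → Reach ends P y x
    Reach-sym here             = here
    Reach-sym (step e pe j w) = Reach-trans (Reach-sym w) (Reach-edge pe (Joins-sym j))

    Reach-invariant : {A : Set} (g : Fin n → A) → (∀ {e x y} → P e → Joins ends e x y → g x ≡ g y) →
                      ∀ {x y} → Reach ends P x y → g x ≡ g y
    Reach-invariant g g-edge here             = refl
    Reach-invariant g g-edge (step e pe j w) = trans (g-edge pe j) (Reach-invariant g g-edge w)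

    vertices : ∀ {x y} → Reach ends P x y → List (Fin n)
    vertices {x} here           = x ∷ []
    vertices {x} (step _ _ _ w) = x ∷ vertices w

    steps : ∀ {x y} → Reach ends P x y → ℕ
    steps here           = zero
    steps (step _ _ _ w) = suc (steps w)

    vertexAt : ∀ {x y} (w : Reach ends P x y) → Fin (suc (steps w)) → Fin n
    vertexAt {x} w              zero    = x
    vertexAt     (step _ _ _ w) (suc i) = vertexAt w i

    edgeAt : ∀ {x y} (w : Reach ends P x y) → Fin (steps w) → Fin m
    edgeAt (step e _ _ _) zero    = e
    edgeAt (step _ _ _ w) (suc i) = edgeAt w i

    vertexAt-∈ : ∀ {x y} (w : Reach ends P x y) i → vertexAt w i List.∈ vertices w
    vertexAt-∈ here           zero    = here refl
    vertexAt-∈ (step _ _ _ w) zero    = here refl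
    vertexAt-∈ (step _ _ _ w) (suc i) = there (vertexAt-∈ w i)

    vertexAt-last : ∀ {x y} (w : Reach ends P x y) → vertexAt w (fromℕ (steps w)) ≡ y
    vertexAt-last here           = refl
    vertexAt-last (step _ _ _ w) = vertexAt-last w

    edgeAt-∈ : ∀ {x y} (w : Reach ends P x y) i → P (edgeAt w i)
    edgeAt-∈ (step _ pe _ _) zero    = pe
    edgeAt-∈ (step _ _  _ w) (suc i) = edgeAt-∈ w i

    edgeAt-joins : ∀ {x y} (w : Reach ends P x y) i →
                   Joins ends (edgeAt w i) (vertexAt w (inject₁ i)) (vertexAt w (suc i))
    edgeAt-joins (step _ _ j _) zero    = j
    edgeAt-joins (step _ _ _ w) (suc i) = edgeAt-joins w i

    vertexAt-injective : ∀ {x y} (w : Reach ends P x y) → Unique (vertices w) → Injective _≡_ _≡_ (vertexAt w)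
    vertexAt-injective here           _            {zero}  {zero}  _  = refl
    vertexAt-injective (step _ _ _ w) _            {zero}  {zero}  _  = refl
    vertexAt-injective (step _ _ _ w) (x∉w ∷ _)   {zero}  {suc j} eq =
      ⊥-elim (All¬⇒¬Any x∉w (subst (List._∈ vertices w) (sym eq) (vertexAt-∈ w j)))
    vertexAt-injective (step _ _ _ w) (x∉w ∷ _)   {suc i} {zero}  eq =
      ⊥-elim (All¬⇒¬Any x∉w (subst (List._∈ vertices w) eq (vertexAt-∈ w i)))
    vertexAt-injective (step _ _ _ w) (_ ∷ uw)    {suc i} {suc j} eq = cong suc (vertexAt-injective w uw eq)

    first-edge-fresh : ∀ {e x y z} → Joins ends e x y → (w : Reach ends P y z) →
                       All (x ≢_) (vertices w) → ∀ i → e ≢ edgeAt w i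
    first-edge-fresh j w x∉w i refl with Joins-endpoint j (edgeAt-joins w i)
    ... | inj₁ x≡ = All¬⇒¬Any x∉w (subst (List._∈ vertices w) (sym x≡) (vertexAt-∈ w (inject₁ i)))
    ... | inj₂ x≡ = All¬⇒¬Any x∉w (subst (List._∈ vertices w) (sym x≡) (vertexAt-∈ w (suc i)))

    edgeAt-injective : ∀ {x y} (w : Reach ends P x y) → Unique (vertices w) → Injective _≡_ _≡_ (edgeAt w)
    edgeAt-injective (step _ _ _ w) _         {zero}  {zero}  _  = refl
    edgeAt-injective (step _ _ j w) (x∉w ∷ _) {zero}  {suc i} eq = ⊥-elim (first-edge-fresh j w x∉w i eq)
    edgeAt-injective (step _ _ j w) (x∉w ∷ _) {suc i} {zero}  eq = ⊥-elim (first-edge-fresh j w x∉w i (sym eq))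
    edgeAt-injective (step _ _ _ w) (_ ∷ uw)  {suc i} {suc j} eq = cong suc (edgeAt-injective w uw eq)

  Path : (Fin m → Set) → Fin n → Fin n → Set
  Path P x y = Σ (Reach ends P x y) (λ w → Unique (vertices w))

  pathFrom : ∀ {P x y z} (w : Reach ends P y z) → Unique (vertices w) → x List.∈ vertices w → Path P x z
  pathFrom here           uw        (here refl) = here , uw
  pathFrom (step e pe j w) uw       (here refl) = step e pe j w , uw
  pathFrom (step _ _ _ w) (_ ∷ uw) (there x∈w) = pathFrom w uw x∈w

  toPath : ∀ {P x y} → Reach ends P x y → Path P x y
  toPath here = here , [] ∷ []
  toPath {x = x} (step e pe j w) with toPath w
  ... | w′ , uw′ with any? (x ≟ᶠ_) (vertices w′)
  ...   | yes x∈w′ = pathFrom w′ uw′ x∈w′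
  ...   | no  x∉w′ = step e pe j w′ , ¬Any⇒All¬ _ x∉w′ ∷ uw′

  Reach-mono : ∀ {P Q} → P ⊆ Q → ∀ {x y} → Reach ends P x y → Reach ends Q x y
  Reach-mono P⊆Q here            = here
  Reach-mono P⊆Q (step e pe j w) = step e (P⊆Q pe) j (Reach-mono P⊆Q w)

  Cycle-mono : ∀ {P Q} → P ⊆ Q → Cycle ends P → Cycle ends Q
  Cycle-mono P⊆Q c = record { Cycle c; inP = λ i → P⊆Q (inP i) }
    where open Cycle c

  chord⇒Cycle : ∀ {P Q} → Q ⊆ P → ∀ {e u v} → P e → ¬ Q e → Joins ends e u v → Reach ends Q v u → Cycle ends P
  chord⇒Cycle {P} {Q} Q⊆P {e} {u} {v} pe ¬qe j v→u = record
    { k = steps w ; vs = vs ; es = es ; inP = inP ; join = join ; closed = vertexAt-last w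
    ; es-inj = es-inj ; vs-inj = vs-inj }
    where
    w  = proj₁ (toPath v→u)
    uw = proj₂ (toPath v→u)
    vs : Fin (suc (suc (steps w))) → Fin n
    vs zero    = u
    vs (suc i) = vertexAt w i
    es : Fin (suc (steps w)) → Fin m
    es zero    = e
    es (suc i) = edgeAt w i
    inP : ∀ i → P (es i)
    inP zero    = pe
    inP (suc i) = Q⊆P (edgeAt-∈ w i)
    vertexAt-first : ∀ {x} (w′ : Reach ends Q v x) → vertexAt w′ zero ≡ v
    vertexAt-first here           = refl
    vertexAt-first (step _ _ _ _) = refl
    join : ∀ i → Joins ends (es i) (vs (inject₁ i)) (vs (suc i))
    join zero    = subst (Joins ends e u) (sym (vertexAt-first w)) j
    join (suc i) = edgeAt-joins w i
    es-inj : Injective _≡_ _≡_ es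
    es-inj {zero}  {zero}  _  = refl
    es-inj {zero}  {suc i} eq = ⊥-elim (¬qe (subst Q (sym eq) (edgeAt-∈ w i)))
    es-inj {suc i} {zero}  eq = ⊥-elim (¬qe (subst Q eq (edgeAt-∈ w i)))
    es-inj {suc i} {suc j} eq = cong suc (edgeAt-injective w uw eq)
    vs-inj : Injective _≡_ _≡_ (λ i → vs (inject₁ i))
    vs-inj {zero}  {zero}  _  = refl
    vs-inj {zero}  {suc i} eq = ⊥-elim (fromℕ≢inject₁ {i = i} (vertexAt-injective w uw (trans (vertexAt-last w) eq)))
    vs-inj {suc i} {zero}  eq = ⊥-elim (fromℕ≢inject₁ {i = i} (vertexAt-injective w uw (trans (vertexAt-last w) (sym eq))))
    vs-inj {suc i} {suc j} eq = cong suc (inject₁-injective (vertexAt-injective w uw eq))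

module Components {n m : ℕ} (ends : Ends n m) where
  open Walks ends

  record Labelling (L : List (Fin m)) : Set where
    field
      rep         : Fin n → Fin n
      reach-rep   : ∀ x → Reach ends (List._∈ L) x (rep x)
      rep-resp    : ∀ {x y} → Reach ends (List._∈ L) x y → rep x ≡ rep y
      rep-reflect : ∀ {x y} → rep x ≡ rep y → Reach ends (List._∈ L) x y

    rep-idem : ∀ x → rep (rep x) ≡ rep x
    rep-idem x = sym (rep-resp (reach-rep x))

    IsRep? : Decidable (λ x → rep x ≡ x)
    IsRep? x = rep x ≟ᶠ x

    #components : ℕ
    #components = count IsRep? (allFin n)

  discrete : Labelling []
  discrete = record { rep = id ; reach-rep = λ _ → here ; rep-resp = no-edges ; rep-reflect = λ { refl → here } }
    where
    no-edges : ∀ {x y} → Reach ends (List._∈ []) x y → x ≡ y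
    no-edges here           = refl
    no-edges (step _ () _ _)

  #components-discrete : Labelling.#components discrete ≡ n
  #components-discrete = trans (cong length (filter-all (Labelling.IsRep? discrete) (All.universal (λ _ → refl) (allFin n))))
                               (length-tabulate id)

  module Extend {L : List (Fin m)} (C : Labelling L) (e : Fin m) where
    private
      u = proj₁ (ends e)
      v = proj₂ (ends e)
      module C = Labelling C
      open C using (rep)

    widen : ∀ {x y} → Reach ends (List._∈ L) x y → Reach ends (List._∈ e ∷ L) x y
    widen = Reach-mono there

    invariant-∷ : (g : Fin n → Fin n) → (∀ {x y} → rep x ≡ rep y → g x ≡ g y) → g u ≡ g v →
             ∀ {x y} → Reach ends (List._∈ e ∷ L) x y → g x ≡ g y
    invariant-∷ g g-resp guv = Reach-invariant g λ where
      (here refl) j → Joins-resp g guv j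
      (there f∈L) j → g-resp (C.rep-resp (Reach-edge f∈L j))

    within : rep u ≡ rep v → Labelling (e ∷ L)
    within ru≡rv = record
      { rep = rep ; reach-rep = λ x → widen (C.reach-rep x)
      ; rep-resp = invariant-∷ rep id ru≡rv ; rep-reflect = λ eq → widen (C.rep-reflect eq) }

    module Merge (ru≢rv : rep u ≢ rep v) where

      rep′ : Fin n → Fin n
      rep′ x with rep x ≟ᶠ rep v
      ... | yes _ = rep u
      ... | no  _ = rep x

      rep′-resp : ∀ {x y} → rep x ≡ rep y → rep′ x ≡ rep′ y
      rep′-resp {x} {y} eq with rep x ≟ᶠ rep v | rep y ≟ᶠ rep v
      ... | yes _  | yes _  = refl
      ... | yes rx | no ¬ry = ⊥-elim (¬ry (trans (sym eq) rx))
      ... | no ¬rx | yes ry = ⊥-elim (¬rx (trans eq ry))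
      ... | no _   | no _   = eq

      rep′-u : rep′ u ≡ rep u
      rep′-u with rep u ≟ᶠ rep v
      ... | yes ru≡rv = ⊥-elim (ru≢rv ru≡rv)
      ... | no  _     = refl

      rep′-v : rep′ v ≡ rep u
      rep′-v with rep v ≟ᶠ rep v
      ... | yes _     = refl
      ... | no  rv≢rv = ⊥-elim (rv≢rv refl)

      v→u : Reach ends (List._∈ e ∷ L) v u
      v→u = Reach-edge (here refl) (Joins-sym (inj₁ refl))

      reach-rep′ : ∀ x → Reach ends (List._∈ e ∷ L) x (rep′ x)
      reach-rep′ x with rep x ≟ᶠ rep v
      ... | yes rx≡rv = Reach-trans (widen (C.rep-reflect rx≡rv)) (Reach-trans v→u (widen (C.reach-rep u)))
      ... | no  _     = widen (C.reach-rep x)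

      rep′-reflect : ∀ {x y} → rep′ x ≡ rep′ y → Reach ends (List._∈ e ∷ L) x y
      rep′-reflect {x} {y} eq with rep x ≟ᶠ rep v | rep y ≟ᶠ rep v
      ... | yes rx | yes ry = widen (C.rep-reflect (trans rx (sym ry)))
      ... | yes rx | no _   = Reach-trans (widen (C.rep-reflect rx)) (Reach-trans v→u (widen (C.rep-reflect eq)))
      ... | no _   | yes ry = Reach-trans (widen (C.rep-reflect eq)) (Reach-trans (Reach-sym v→u) (widen (C.rep-reflect (sym ry))))
      ... | no _   | no _   = widen (C.rep-reflect eq)

      merged : Labelling (e ∷ L)
      merged = record
        { rep = rep′ ; reach-rep = reach-rep′
        ; rep-resp = invariant-∷ rep′ rep′-resp (trans rep′-u (sym rep′-v)) ; rep-reflect = rep′-reflect }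

      isRep′⇒isRep : ∀ x → rep′ x ≡ x → rep x ≡ x × x ≢ rep v
      isRep′⇒isRep x eq with rep x ≟ᶠ rep v
      ... | yes rx≡rv = ⊥-elim (ru≢rv (trans (sym (C.rep-idem u)) (trans (cong rep eq) rx≡rv)))
      ... | no  rx≢rv = eq , λ x≡rv → rx≢rv (trans (cong rep x≡rv) (C.rep-idem v))

      isRep⇒isRep′ : ∀ x → rep x ≡ x × x ≢ rep v → rep′ x ≡ x
      isRep⇒isRep′ x (rx≡x , x≢rv) with rep x ≟ᶠ rep v
      ... | yes rx≡rv = ⊥-elim (x≢rv (trans (sym rx≡x) rx≡rv))
      ... | no  _     = rx≡x

      #components-merged : C.#components ≡ suc (Labelling.#components merged)
      #components-merged =
        trans (count-remove _≟ᶠ_ C.IsRep? (allFin⁺ n) (∈-allFin (rep v)) (C.rep-idem v))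
              (cong suc (count-≐ _ (Labelling.IsRep? merged) ((λ {x} → isRep⇒isRep′ x) , (λ {x} → isRep′⇒isRep x)) (allFin n)))

  record Counted (L : List (Fin m)) : Set where
    field
      labelling   : Labelling L
      n≤∣L∣+#components  : n ≤ length L + Labelling.#components labelling
      acyclic⇒∣L∣+#components≡n : ¬ Cycle ends (List._∈ L) → length L + Labelling.#components labelling ≡ n

  -- Insert the edges one at a time: an edge inside a component closes a cycle, any other edge
  -- merges two components.
  components : ∀ L → Unique L → Counted L
  components []      _          = record
    { labelling = discrete ; n≤∣L∣+#components = ≤-reflexive (sym #components-discrete) ; acyclic⇒∣L∣+#components≡n = λ _ → #components-discrete }
  components (e ∷ L) (e∉L ∷ uL) = extend (components L uL)
    where
    u = proj₁ (ends e)
    v = proj₂ (ends e)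
    extend : Counted L → Counted (e ∷ L)
    extend record { labelling = C ; n≤∣L∣+#components = lower ; acyclic⇒∣L∣+#components≡n = rank }
      with Labelling.rep C u ≟ᶠ Labelling.rep C v
    ... | yes ru≡rv = record
      { labelling   = Extend.within C e ru≡rv
      ; n≤∣L∣+#components  = m≤n⇒m≤1+n lower
      ; acyclic⇒∣L∣+#components≡n = λ acyclic → ⊥-elim (acyclic
          (chord⇒Cycle there (here refl) (All¬⇒¬Any e∉L) (inj₁ refl) (Labelling.rep-reflect C (sym ru≡rv)))) }
    ... | no ru≢rv = record
      { labelling   = merged
      ; n≤∣L∣+#components  = subst (n ≤_) one-less lower
      ; acyclic⇒∣L∣+#components≡n = λ acyclic → trans (sym one-less) (rank (λ c → acyclic (Cycle-mono there c))) }
      where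
      open Extend.Merge C e ru≢rv
      one-less : length L + Labelling.#components C ≡ suc (length L) + Labelling.#components merged
      one-less = trans (cong (length L +_) #components-merged) (+-suc _ _)

module InducedSubgraph {n m : ℕ} (ends : Ends n m) where
  open Walks ends
  open Components ends

  EdgeIn? : ∀ e F → Dec (EdgeIn ends e F)
  EdgeIn? e F = (proj₁ (ends e) ∈? F) ×-dec (proj₂ (ends e) ∈? F)

  Induced? : ∀ B F → Decidable (Induced ends B F)
  Induced? B F e = (e ∈? B) ×-dec EdgeIn? e F

  ∣_[_]∣ : Subset m → Subset n → ℕ
  ∣ B [ F ]∣ = count (Induced? B F) (allFin m)

  size : Subset n → ℕ
  size F = count (_∈? F) (allFin n)

  Spans : Subset n → (Fin m → Set) → Set
  Spans F P = ∀ x y → x ∈ F → y ∈ F → Reach ends P x y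

  -- B[F] is viewed as an edge set on all of Fin n; the vertices outside F are then isolated, so
  -- the components not meeting F are exactly those singletons.
  module _ (B : Subset m) (F : Subset n) where
    private
      L = filter (Induced? B F) (allFin m)
      open Counted (components L (filter⁺ (Induced? B F) (allFin⁺ m)))
      open Labelling labelling

      toL : ∀ {e} → Induced ends B F e → e List.∈ L
      toL = ∈-filter⁺ (Induced? B F) (∈-allFin _)

      fromL : ∀ {e} → e List.∈ L → Induced ends B F e
      fromL e∈L = proj₂ (∈-filter⁻ (Induced? B F) {xs = allFin m} e∈L)

      ends-in-F : ∀ {e x y} → e List.∈ L → Joins ends e x y → x ∈ F × y ∈ F
      ends-in-F e∈L (inj₁ refl) = proj₂ (fromL e∈L)
      ends-in-F e∈L (inj₂ refl) = let (x∈F , y∈F) = proj₂ (fromL e∈L) in y∈F , x∈F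

      reach-stays-in : ∀ {x y} → Reach ends (List._∈ L) x y → x ∈ F → y ∈ F
      reach-stays-in here              x∈F = x∈F
      reach-stays-in (step _ e∈L j w) x∈F = reach-stays-in w (proj₂ (ends-in-F e∈L j))

      outside-isolated : ∀ {x y} → Reach ends (List._∈ L) x y → x ∉ F → x ≡ y
      outside-isolated here              _   = refl
      outside-isolated (step _ e∈L j _) x∉F = ⊥-elim (x∉F (proj₁ (ends-in-F e∈L j)))

      IsRepIn? : Decidable (λ x → rep x ≡ x × x ∈ F)
      IsRepIn? x = IsRep? x ×-dec x ∈? F

      #reps : ℕ
      #reps = count IsRepIn? (allFin n)

      #outside : ℕ
      #outside = count (∁? (_∈? F)) (allFin n)

      n≡size+#outside : n ≡ size F + #outside
      n≡size+#outside = trans (sym (length-tabulate id)) (length≡count+count∁ (_∈? F) (allFin n))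

      #components≡#reps+#outside : #components ≡ #reps + #outside
      #components≡#reps+#outside = trans (count-split IsRep? (_∈? F) (allFin n))
        (cong (#reps +_) (count-≐ _ (∁? (_∈? F)) (proj₂ , λ {x} x∉F → sym (outside-isolated (reach-rep x) x∉F) , x∉F) (allFin n)))

      size-lower : size F ≤ ∣ B [ F ]∣ + #reps
      size-lower = +-cancelʳ-≤ #outside _ _ (begin
        size F + #outside                  ≡⟨ n≡size+#outside ⟨
        n                                  ≤⟨ n≤∣L∣+#components ⟩
        ∣ B [ F ]∣ + #components           ≡⟨ cong (∣ B [ F ]∣ +_) #components≡#reps+#outside ⟩
        ∣ B [ F ]∣ + (#reps + #outside)    ≡⟨ +-assoc ∣ B [ F ]∣ #reps #outside ⟨
        ∣ B [ F ]∣ + #reps + #outside      ∎)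
        where open ≤-Reasoning

      size-exact : ¬ Cycle ends (Induced ends B F) → ∣ B [ F ]∣ + #reps ≡ size F
      size-exact acyclic = +-cancelʳ-≡ #outside _ _ (begin
        ∣ B [ F ]∣ + #reps + #outside      ≡⟨ +-assoc ∣ B [ F ]∣ #reps #outside ⟩
        ∣ B [ F ]∣ + (#reps + #outside)    ≡⟨ cong (∣ B [ F ]∣ +_) #components≡#reps+#outside ⟨
        ∣ B [ F ]∣ + #components           ≡⟨ acyclic⇒∣L∣+#components≡n (λ c → acyclic (Cycle-mono fromL c)) ⟩
        n                                  ≡⟨ n≡size+#outside ⟩
        size F + #outside                  ∎)
        where open ≡-Reasoning

      rep-IsRepIn : ∀ {x} → x ∈ F → rep (rep x) ≡ rep x × rep x ∈ F
      rep-IsRepIn {x} x∈F = rep-idem x , reach-stays-in (reach-rep x) x∈F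

      #reps≥1 : ∀ {x} → x ∈ F → 1 ≤ #reps
      #reps≥1 x∈F = count-pos IsRepIn? (∈-allFin _) (rep-IsRepIn x∈F)

      #reps≥2 : ∀ {x y} → x ∈ F → y ∈ F → rep x ≢ rep y → 2 ≤ #reps
      #reps≥2 {x} {y} x∈F y∈F rx≢ry =
        subst (2 ≤_) (sym (count-remove _≟ᶠ_ IsRepIn? (allFin⁺ n) (∈-allFin _) (rep-IsRepIn x∈F)))
              (s≤s (count-pos (λ z → IsRepIn? z ×-dec ¬? (z ≟ᶠ rep x)) (∈-allFin _) (rep-IsRepIn y∈F , λ ry≡rx → rx≢ry (sym ry≡rx))))

      spans⇒#reps≤1 : Spans F (Induced ends B F) → #reps ≤ 1
      spans⇒#reps≤1 spans = count-≤1 IsRepIn? same-rep (allFin⁺ n)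
        where
        same-rep : ∀ {x y} → rep x ≡ x × x ∈ F → rep y ≡ y × y ∈ F → x ≡ y
        same-rep {x} {y} (rx≡x , x∈F) (ry≡y , y∈F) =
          trans (sym rx≡x) (trans (rep-resp (Reach-mono toL (spans x y x∈F y∈F))) ry≡y)

    forest⇒size : (∃[ x ] x ∈ F) → ¬ Cycle ends (Induced ends B F) → suc ∣ B [ F ]∣ ≤ size F
    forest⇒size (x , x∈F) acyclic = begin
      suc ∣ B [ F ]∣          ≡⟨ +-comm 1 ∣ B [ F ]∣ ⟩
      ∣ B [ F ]∣ + 1          ≤⟨ +-monoʳ-≤ ∣ B [ F ]∣ (#reps≥1 x∈F) ⟩
      ∣ B [ F ]∣ + #reps      ≡⟨ size-exact acyclic ⟩
      size F                  ∎
      where open ≤-Reasoning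

    spans⇒size : Spans F (Induced ends B F) → size F ≤ suc ∣ B [ F ]∣
    spans⇒size spans = begin
      size F                  ≤⟨ size-lower ⟩
      ∣ B [ F ]∣ + #reps      ≤⟨ +-monoʳ-≤ ∣ B [ F ]∣ (spans⇒#reps≤1 spans) ⟩
      ∣ B [ F ]∣ + 1          ≡⟨ +-comm ∣ B [ F ]∣ 1 ⟩
      suc ∣ B [ F ]∣          ∎
      where open ≤-Reasoning

    forest∧size⇒spans : ¬ Cycle ends (Induced ends B F) → size F ≤ suc ∣ B [ F ]∣ → Spans F (Induced ends B F)
    forest∧size⇒spans acyclic size≤ x y x∈F y∈F with rep x ≟ᶠ rep y
    ... | yes rx≡ry = Reach-mono fromL (rep-reflect rx≡ry)
    ... | no  rx≢ry = ⊥-elim (1+n≰n (≤-trans (#reps≥2 x∈F y∈F rx≢ry) #reps≤1))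
      where
      #reps≤1 : #reps ≤ 1
      #reps≤1 = +-cancelˡ-≤ ∣ B [ F ]∣ _ _
        (subst₂ _≤_ (sym (size-exact acyclic)) (+-comm 1 ∣ B [ F ]∣) size≤)

  forest-induced : ∀ {B} → SpanningTree ends B → ∀ F → ¬ Cycle ends (Induced ends B F)
  forest-induced (_ , _ , acyclic) F c = acyclic (Cycle-mono proj₁ c)

  forest≤tree : ∀ {T B F} → IsTreeOn ends F (Induced ends T F) → ¬ Cycle ends (Induced ends B F) →
               ∣ B [ F ]∣ ≤ ∣ T [ F ]∣
  forest≤tree {T} {B} {F} (nonempty , spans , _) B-acyclic =
    ≤-pred (≤-trans (forest⇒size B F nonempty B-acyclic) (spans⇒size T F spans))

  forest≥tree⇒tree : ∀ {T B F} → IsTreeOn ends F (Induced ends T F) → ¬ Cycle ends (Induced ends B F) →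
                 ∣ T [ F ]∣ ≤ ∣ B [ F ]∣ → IsTreeOn ends F (Induced ends B F)
  forest≥tree⇒tree {T} {B} {F} (nonempty , spans , _) B-acyclic T≤B =
    nonempty , forest∧size⇒spans B F B-acyclic (≤-trans (spans⇒size T F spans) (s≤s T≤B)) , B-acyclic

  weight≡count : ∀ 𝓕 B e → (if lookup B e then c₁ ends 𝓕 e else 0) ≡ count (λ F → Induced? B F e) 𝓕
  weight≡count 𝓕 B e with lookup B e in lookup≡
  ... | true  = count-≐ (EdgeIn? e) (λ F → Induced? B F e) ((lookup⇒[]= e B lookup≡ ,_) , proj₂) 𝓕
  ... | false = sym (cong length (filter-none (λ F → Induced? B F e) (All.universal (λ _ → e∉B ∘′ proj₁) 𝓕)))
    where
    e∉B : ¬ e ∈ B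
    e∉B e∈B with trans (sym ([]=⇒lookup e∈B)) lookup≡
    ... | ()

  -- Double counting the pairs (e, F) with e ∈ B[F].
  cost≡Σ∣B[F]∣ : ∀ 𝓕 B → cost ends 𝓕 B ≡ sum (map (λ F → ∣ B [ F ]∣) 𝓕)
  cost≡Σ∣B[F]∣ 𝓕 B = trans (cong sum (map-cong (weight≡count 𝓕 B) (allFin m)))
                            (count-swap (λ e F → Induced? B F e) (allFin m) 𝓕)

claim11 : (n m : ℕ) (ends : Ends n m) → Simple ends → Connected ends →
          (𝓕 : List (Subset n)) → Unique 𝓕 →
          (∃[ B ] Tight ends 𝓕 B) →
          (B : Subset m) → Tight ends 𝓕 B ⇔ MaxCostSpanningTree ends 𝓕 B
claim11 n m ends _ _ 𝓕 _ (T , T-spanning , T-tight) B = mk⇔ tight⇒max max⇒tight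
  where
  open InducedSubgraph ends

  tight⇒max : Tight ends 𝓕 B → MaxCostSpanningTree ends 𝓕 B
  tight⇒max (B-spanning , B-tight) = B-spanning , λ B′ B′-spanning →
    subst₂ _≤_ (sym (cost≡Σ∣B[F]∣ 𝓕 B′)) (sym (cost≡Σ∣B[F]∣ 𝓕 B))
      (sum-mono-≤ (λ F∈𝓕 → forest≤tree (B-tight _ F∈𝓕) (forest-induced B′-spanning _)))

  max⇒tight : MaxCostSpanningTree ends 𝓕 B → Tight ends 𝓕 B
  max⇒tight (B-spanning , B-max) = B-spanning , λ F F∈𝓕 →
    forest≥tree⇒tree (T-tight F F∈𝓕) (forest-induced B-spanning F) (T[F]≤B[F] F∈𝓕)
    where
    T[F]≤B[F] : ∀ {F} → F List.∈ 𝓕 → ∣ T [ F ]∣ ≤ ∣ B [ F ]∣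
    T[F]≤B[F] = sum-mono-≤-rigid (λ F∈𝓕 → forest≤tree (T-tight _ F∈𝓕) (forest-induced B-spanning _))
                          (subst₂ _≤_ (cost≡Σ∣B[F]∣ 𝓕 T) (cost≡Σ∣B[F]∣ 𝓕 B) (B-max T T-spanning))
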